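{- Suppose $G=(V,E)$ is an $(\alpha,\beta)$-expander with maximum degree $\Delta$. Then $G$ is also an $(\alpha_w,\beta_w)$-wireless expander with $\alpha_w=\alpha$ and $\beta_w\geq 2\beta-\Delta$.
   Context: $G=(V,E)$ is a finite undirected graph with $n=|V|$ vertices. For $S\subseteq V$, $\Gamma(S)$ is the set of neighbors of vertices of $S$ and $\Gamma^-(S)=\Gamma(S)\setminus S$. $G$ is an $(\alpha,\beta)$-expander if $|\Gamma^-(S)|\geq\beta|S|$ for all $S\subseteq V$ with $|S|\leq\alpha n$. $G$ is an $(\alpha_w,\beta_w)$-wireless expander if for every $S\subseteq V$ with $|S|\leq\alpha_w n$ there exists $S'\subseteq S$ such that at least $\beta_w|S|$ vertices of $V\setminus S$ are adjacent to exactly one vertex of $S'$.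
   Formalization: The expansion parameters α and β, and with them α_w and β_w, are taken to be rational numbers. -}

module Defs where

open import Data.Nat using (ℕ; zero; suc)
open import Data.Bool using (Bool; true; false; _∧_; _∨_; not; T)
open import Data.Fin using (Fin)
open import Data.Fin.Subset using (Subset; _∈_; _∉_; _⊆_; ∣_∣; _∩_)
open import Data.Vec using (tabulate; lookup)
open import Data.Integer using (+_)
open import Data.Rational using (ℚ; _/_; _*_; _≤_)
open import Data.Product using (Σ; _×_; ∃)
open import Relation.Binary.PropositionalEquality using (_≡_)

⟦_⟧ : ℕ → ℚ
⟦ k ⟧ = (+ k) / 1

record Graph (n : ℕ) : Set where
  field
    adj     : Fin n → Fin n → Bool
    symm    : ∀ u v → adj u v ≡ adj v u
    irrefl  : ∀ v → adj v v ≡ false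
open Graph public

anyᵇ : ∀ {n} → (Fin n → Bool) → Bool
anyᵇ {zero}  p = false
anyᵇ {suc n} p = p Fin.zero ∨ anyᵇ (λ i → p (Fin.suc i))

module _ {n : ℕ} (G : Graph n) where

  N : Fin n → Subset n
  N v = tabulate (adj G v)

  degree : Fin n → ℕ
  degree v = ∣ N v ∣

  MaxDegree : ℕ → Set
  MaxDegree Δ = (∀ v → degree v Data.Nat.≤ Δ) × ∃ (λ v → degree v ≡ Δ)

  Γ : Subset n → Subset n
  Γ S = tabulate (λ u → anyᵇ (λ v → lookup S v ∧ adj G v u))

  Γ⁻ : Subset n → Subset n
  Γ⁻ S = tabulate (λ u → lookup (Γ S) u ∧ not (lookup S u))

  IsExpander : ℚ → ℚ → Set
  IsExpander α β =
    ∀ (S : Subset n) → ⟦ ∣ S ∣ ⟧ ≤ α * ⟦ n ⟧ → β * ⟦ ∣ S ∣ ⟧ ≤ ⟦ ∣ Γ⁻ S ∣ ⟧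

  UniqueNbrs : Subset n → Subset n → Subset n
  UniqueNbrs S S' = tabulate (λ u → not (lookup S u) ∧ isOne ∣ S' ∩ N u ∣)
    where
      isOne : ℕ → Bool
      isOne (suc zero) = true
      isOne _          = false

  IsWirelessExpander : ℚ → ℚ → Set
  IsWirelessExpander αw βw =
    ∀ (S : Subset n) → ⟦ ∣ S ∣ ⟧ ≤ αw * ⟦ n ⟧ →
      Σ (Subset n) (λ S' → S' ⊆ S × βw * ⟦ ∣ S ∣ ⟧ ≤ ⟦ ∣ UniqueNbrs S S' ∣ ⟧)

module Submission where

-- Proof idea (take S' = S).  Fix S with |S| ≤ αn and write c(u) = |S ∩ N(u)| for the
-- number of neighbours of u inside S.  Every u ∈ Γ⁻(S) has c(u) ≥ 1, and either
-- c(u) = 1, in which case u is a unique neighbour of S, or c(u) ≥ 2.  Hence pointwise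
--     2·[u ∈ Γ⁻(S)]  ≤  [u ∈ UniqueNbrs S S] + c(u).
-- Summing over u and double counting the pairs (u, v) with v ∈ S adjacent to u,
--     Σ_u c(u) = Σ_{v ∈ S} deg v ≤ Δ|S|,   so   2|Γ⁻(S)| ≤ |UniqueNbrs S S| + Δ|S|.
-- Combined with the expansion bound β|S| ≤ |Γ⁻(S)| this gives
--     (2β − Δ)|S| ≤ 2|Γ⁻(S)| − Δ|S| ≤ |UniqueNbrs S S|.

open import Defs
open import Data.Nat using (ℕ)

module Counting where
  open import Data.Nat.Base
  open import Data.Nat.Properties
    using (+-*-semiring; *-monoʳ-≤; ≤-refl; ≤-trans; +-mono-≤; +-monoʳ-≤; m≤n+m; *-identityˡ; *-comm; module ≤-Reasoning)
  open import Algebra.Properties.Semiring.Sum +-*-semiring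
    using (sum; sum-syntax; sum-cong-≗; sum-replicate-zero; ∑-distrib-+; ∑-comm; *-distribˡ-sum; *-distribʳ-sum)
  open import Data.Bool.Base using (Bool; true; false; _∧_; not)
  open import Data.Fin.Base using (Fin; zero; suc)
  open import Data.Fin.Subset using (Subset; ∣_∣; _∩_)
  open import Data.Vec.Base using ([]; _∷_; lookup; tabulate)
  open import Data.Vec.Properties using (lookup-zipWith; lookup∘tabulate)
  open import Function.Base using (_∋_)
  open import Relation.Binary.PropositionalEquality using (_≡_; refl; sym; trans; cong; module ≡-Reasoning)

  𝟙 : Bool → ℕ
  𝟙 true  = 1
  𝟙 false = 0

  ∑-mono-≤ : ∀ {n} {f g : Fin n → ℕ} → (∀ i → f i ≤ g i) → sum f ≤ sum g
  ∑-mono-≤ {zero}  f≤g = z≤n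
  ∑-mono-≤ {suc n} f≤g = +-mono-≤ (f≤g zero) (∑-mono-≤ (λ i → f≤g (suc i)))

  ∣p∣≡∑𝟙 : ∀ {n} (p : Subset n) → ∣ p ∣ ≡ ∑[ i < n ] 𝟙 (lookup p i)
  ∣p∣≡∑𝟙 []          = refl
  ∣p∣≡∑𝟙 (true  ∷ p) = cong suc (∣p∣≡∑𝟙 p)
  ∣p∣≡∑𝟙 (false ∷ p) = ∣p∣≡∑𝟙 p

  ∣tabulate∣≡∑𝟙 : ∀ {n} (f : Fin n → Bool) → ∣ tabulate f ∣ ≡ ∑[ i < n ] 𝟙 (f i)
  ∣tabulate∣≡∑𝟙 f = trans (∣p∣≡∑𝟙 (tabulate f)) (sum-cong-≗ (λ i → cong 𝟙 (lookup∘tabulate f i)))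

  anyᵇ⇒1≤∑𝟙 : ∀ {n} (p : Fin n → Bool) → anyᵇ p ≡ true → 1 ≤ ∑[ i < n ] 𝟙 (p i)
  anyᵇ⇒1≤∑𝟙 {suc n} p some with p zero
  ... | true  = s≤s z≤n
  ... | false = anyᵇ⇒1≤∑𝟙 (λ i → p (suc i)) some

  ∑𝟙-∧ : ∀ {n} (b : Bool) (q : Fin n → Bool) → ∑[ i < n ] 𝟙 (b ∧ q i) ≡ 𝟙 b * ∑[ i < n ] 𝟙 (q i)
  ∑𝟙-∧     true  q = sym (*-identityˡ _)
  ∑𝟙-∧ {n} false q = sum-replicate-zero n

  -- The arithmetic heart of the argument, for a single vertex u: γ says u has a
  -- neighbour in S, σ says u ∈ S, k is the number of neighbours of u in S and b says
  -- u is a unique neighbour of S.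
  boundary≤unique+count : (σ γ b : Bool) (k : ℕ) → (γ ≡ true → 1 ≤ k) →
    (σ ≡ false → k ≡ 1 → b ≡ true) → 2 * 𝟙 (γ ∧ not σ) ≤ 𝟙 b + k
  boundary≤unique+count σ     false b k             _   _      = z≤n
  boundary≤unique+count true  true  b k             _   _      = z≤n
  boundary≤unique+count false true  b zero          hit _      with hit refl
  ... | ()
  boundary≤unique+count false true  b (suc zero)    _   unique rewrite unique refl refl = ≤-refl
  boundary≤unique+count false true  b (suc (suc k)) _   _      = ≤-trans (s≤s (s≤s z≤n)) (m≤n+m _ (𝟙 b))

  module _ {n : ℕ} (G : Graph n) (S : Subset n) where

    ∣S∩N∣≡∑ : ∀ u → ∣ S ∩ N G u ∣ ≡ ∑[ v < n ] 𝟙 (lookup S v ∧ adj G v u)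
    ∣S∩N∣≡∑ u = trans (∣p∣≡∑𝟙 (S ∩ N G u)) (sum-cong-≗ λ v → cong 𝟙 (begin
      lookup (S ∩ N G u) v            ≡⟨ lookup-zipWith _∧_ v S (N G u) ⟩
      lookup S v ∧ lookup (N G u) v   ≡⟨ cong (lookup S v ∧_) (lookup∘tabulate (adj G u) v) ⟩
      lookup S v ∧ adj G u v          ≡⟨ cong (lookup S v ∧_) (symm G u v) ⟩
      lookup S v ∧ adj G v u          ∎))
      where open ≡-Reasoning

    Γ⁻-member : ∀ u → lookup (Γ⁻ G S) u ≡ anyᵇ (λ v → lookup S v ∧ adj G v u) ∧ not (lookup S u)
    Γ⁻-member u = trans (lookup∘tabulate _ u) (cong (_∧ not (lookup S u)) (lookup∘tabulate _ u))

    outside∧one⇒unique : ∀ u → lookup S u ≡ false → ∣ S ∩ N G u ∣ ≡ 1 →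
      lookup (UniqueNbrs G S S) u ≡ true
    outside∧one⇒unique u out one
      with lookup S u | ∣ S ∩ N G u ∣
         | (lookup (UniqueNbrs G S S) u ≡ _) ∋ lookup∘tabulate _ u
    outside∧one⇒unique u refl refl | false | 1 | unfolded = unfolded

    pointwise : ∀ u → 2 * 𝟙 (lookup (Γ⁻ G S) u) ≤ 𝟙 (lookup (UniqueNbrs G S S) u) + ∣ S ∩ N G u ∣
    pointwise u rewrite Γ⁻-member u =
      boundary≤unique+count (lookup S u) _ _ _ hasNbr (outside∧one⇒unique u)
      where
      hasNbr : anyᵇ (λ v → lookup S v ∧ adj G v u) ≡ true → 1 ≤ ∣ S ∩ N G u ∣
      hasNbr some rewrite ∣S∩N∣≡∑ u = anyᵇ⇒1≤∑𝟙 (λ v → lookup S v ∧ adj G v u) some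

    ∑∣S∩N∣≡∑degree : ∑[ u < n ] ∣ S ∩ N G u ∣ ≡ ∑[ v < n ] (𝟙 (lookup S v) * degree G v)
    ∑∣S∩N∣≡∑degree = begin
      ∑[ u < n ] ∣ S ∩ N G u ∣                               ≡⟨ sum-cong-≗ ∣S∩N∣≡∑ ⟩
      ∑[ u < n ] ∑[ v < n ] 𝟙 (lookup S v ∧ adj G v u)      ≡⟨ ∑-comm (λ u v → 𝟙 (lookup S v ∧ adj G v u)) ⟩
      ∑[ v < n ] ∑[ u < n ] 𝟙 (lookup S v ∧ adj G v u)      ≡⟨ sum-cong-≗ (λ v → ∑𝟙-∧ (lookup S v) (adj G v)) ⟩
      ∑[ v < n ] (𝟙 (lookup S v) * ∑[ u < n ] 𝟙 (adj G v u)) ≡⟨ sum-cong-≗ (λ v → cong (𝟙 (lookup S v) *_) (sym (∣tabulate∣≡∑𝟙 (adj G v)))) ⟩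
      ∑[ v < n ] (𝟙 (lookup S v) * degree G v)                 ∎
      where open ≡-Reasoning

    ∑∣S∩N∣≤Δ∣S∣ : (Δ : ℕ) → (∀ v → degree G v ≤ Δ) → ∑[ u < n ] ∣ S ∩ N G u ∣ ≤ Δ * ∣ S ∣
    ∑∣S∩N∣≤Δ∣S∣ Δ degree≤Δ = begin
      ∑[ u < n ] ∣ S ∩ N G u ∣                  ≡⟨ ∑∣S∩N∣≡∑degree ⟩
      ∑[ v < n ] (𝟙 (lookup S v) * degree G v)    ≤⟨ ∑-mono-≤ (λ v → *-monoʳ-≤ (𝟙 (lookup S v)) (degree≤Δ v)) ⟩
      ∑[ v < n ] (𝟙 (lookup S v) * Δ) ≡⟨ sym (*-distribʳ-sum Δ (λ v → 𝟙 (lookup S v))) ⟩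
      (∑[ v < n ] 𝟙 (lookup S v)) * Δ           ≡⟨ cong (_* Δ) (sym (∣p∣≡∑𝟙 S)) ⟩
      ∣ S ∣ * Δ                                 ≡⟨ *-comm ∣ S ∣ Δ ⟩
      Δ * ∣ S ∣                                 ∎
      where open ≤-Reasoning

    2∣Γ⁻∣≤∣unique∣+Δ∣S∣ : (Δ : ℕ) → (∀ v → degree G v ≤ Δ) →
      2 * ∣ Γ⁻ G S ∣ ≤ ∣ UniqueNbrs G S S ∣ + Δ * ∣ S ∣
    2∣Γ⁻∣≤∣unique∣+Δ∣S∣ Δ degree≤Δ = begin
      2 * ∣ Γ⁻ G S ∣                                   ≡⟨ cong (2 *_) (∣p∣≡∑𝟙 (Γ⁻ G S)) ⟩
      2 * ∑[ u < n ] 𝟙 (lookup (Γ⁻ G S) u)             ≡⟨ *-distribˡ-sum 2 (λ u → 𝟙 (lookup (Γ⁻ G S) u)) ⟩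
      ∑[ u < n ] (2 * 𝟙 (lookup (Γ⁻ G S) u)) ≤⟨ ∑-mono-≤ pointwise ⟩
      ∑[ u < n ] (𝟙 (lookup U u) + ∣ S ∩ N G u ∣)      ≡⟨ ∑-distrib-+ (λ u → 𝟙 (lookup U u)) (λ u → ∣ S ∩ N G u ∣) ⟩
      ∑[ u < n ] 𝟙 (lookup U u) + ∑[ u < n ] ∣ S ∩ N G u ∣ ≡⟨ cong (_+ ∑[ u < n ] ∣ S ∩ N G u ∣) (sym (∣p∣≡∑𝟙 U)) ⟩
      ∣ U ∣ + ∑[ u < n ] ∣ S ∩ N G u ∣                  ≤⟨ +-monoʳ-≤ ∣ U ∣ (∑∣S∩N∣≤Δ∣S∣ Δ degree≤Δ) ⟩
      ∣ U ∣ + Δ * ∣ S ∣                                 ∎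
      where
      open ≤-Reasoning
      U : Subset n
      U = UniqueNbrs G S S

module Embedding where
  open import Data.Nat.Base as ℕ using (ℕ)
  open import Data.Integer.Base as ℤ using (+_; +≤+)
  import Data.Integer.Properties as ℤ
  open import Data.Rational.Base
  open import Data.Rational.Properties
  import Data.Rational.Unnormalised.Base as ℚᵘ
  import Data.Rational.Unnormalised.Properties as ℚᵘ
  open import Data.Nat.Coprimality using (1-coprimeTo) renaming (sym to coprime-sym)
  open import Data.Rational.Solver using (module +-*-Solver)
  open import Relation.Binary.PropositionalEquality using (_≡_; refl; sym; cong; cong₂; subst₂)

  -- ⟦ k ⟧ = (+ k) / 1 normalises to the rational with numerator k and denominator 1;
  -- in the latter form the operations of ℚ compute on it by the obvious integer identities.
  ι : ℕ → ℚ
  ι k = mkℚ (+ k) 0 (coprime-sym (1-coprimeTo k))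

  ⟦⟧≡ι : ∀ k → ⟦ k ⟧ ≡ ι k
  ⟦⟧≡ι k = ↥p/↧p≡p (ι k)

  ⟦⟧-+ : ∀ a b → ⟦ a ℕ.+ b ⟧ ≡ ⟦ a ⟧ + ⟦ b ⟧
  ⟦⟧-+ a b rewrite ⟦⟧≡ι a | ⟦⟧≡ι b | ⟦⟧≡ι (a ℕ.+ b) =
    toℚᵘ-injective (ℚᵘ.≃-trans (ℚᵘ.*≡* numerators) (ℚᵘ.≃-sym (toℚᵘ-homo-+ (ι a) (ι b))))
    where
    numerators : + (a ℕ.+ b) ℤ.* + 1 ≡ (+ a ℤ.* + 1 ℤ.+ + b ℤ.* + 1) ℤ.* + 1
    numerators rewrite ℤ.*-identityʳ (+ a) | ℤ.*-identityʳ (+ b) = cong (ℤ._* + 1) (ℤ.pos-+ a b)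

  ⟦⟧-* : ∀ a b → ⟦ a ℕ.* b ⟧ ≡ ⟦ a ⟧ * ⟦ b ⟧
  ⟦⟧-* a b rewrite ⟦⟧≡ι a | ⟦⟧≡ι b | ⟦⟧≡ι (a ℕ.* b) =
    toℚᵘ-injective (ℚᵘ.≃-trans (ℚᵘ.*≡* (cong (ℤ._* + 1) (ℤ.pos-* a b))) (ℚᵘ.≃-sym (toℚᵘ-homo-* (ι a) (ι b))))

  ⟦⟧-mono-≤ : ∀ {a b} → a ℕ.≤ b → ⟦ a ⟧ ≤ ⟦ b ⟧
  ⟦⟧-mono-≤ {a} {b} a≤b rewrite ⟦⟧≡ι a | ⟦⟧≡ι b =
    *≤* (subst₂ ℤ._≤_ (sym (ℤ.*-identityʳ (+ a))) (sym (ℤ.*-identityʳ (+ b))) (+≤+ a≤b))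

  scaled-bound : ∀ (β : ℚ) (s g U Δ : ℕ) → β * ⟦ s ⟧ ≤ ⟦ g ⟧ → 2 ℕ.* g ℕ.≤ U ℕ.+ Δ ℕ.* s →
    (⟦ 2 ⟧ * β - ⟦ Δ ⟧) * ⟦ s ⟧ ≤ ⟦ U ⟧
  scaled-bound β s g U Δ expansion counting = begin
    (⟦ 2 ⟧ * β - ⟦ Δ ⟧) * ⟦ s ⟧          ≡⟨ solve 4 (λ t b d x → (t :* b :- d) :* x := t :* (b :* x) :- d :* x)
                                                refl ⟦ 2 ⟧ β ⟦ Δ ⟧ ⟦ s ⟧ ⟩
    ⟦ 2 ⟧ * (β * ⟦ s ⟧) - ⟦ Δ ⟧ * ⟦ s ⟧  ≤⟨ +-monoˡ-≤ (- (⟦ Δ ⟧ * ⟦ s ⟧)) (*-monoˡ-≤-nonNeg ⟦ 2 ⟧ expansion) ⟩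
    ⟦ 2 ⟧ * ⟦ g ⟧ - ⟦ Δ ⟧ * ⟦ s ⟧        ≡⟨ cong₂ _-_ (sym (⟦⟧-* 2 g)) (sym (⟦⟧-* Δ s)) ⟩
    ⟦ 2 ℕ.* g ⟧ - ⟦ Δ ℕ.* s ⟧            ≤⟨ +-monoˡ-≤ (- ⟦ Δ ℕ.* s ⟧) (⟦⟧-mono-≤ counting) ⟩
    ⟦ U ℕ.+ Δ ℕ.* s ⟧ - ⟦ Δ ℕ.* s ⟧      ≡⟨ cong (_- ⟦ Δ ℕ.* s ⟧) (⟦⟧-+ U (Δ ℕ.* s)) ⟩
    ⟦ U ⟧ + ⟦ Δ ℕ.* s ⟧ - ⟦ Δ ℕ.* s ⟧    ≡⟨ solve 2 (λ u v → u :+ v :- v := u) refl ⟦ U ⟧ ⟦ Δ ℕ.* s ⟧ ⟩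
    ⟦ U ⟧                                ∎
    where
    open ≤-Reasoning
    open +-*-Solver using (solve; _:+_; _:-_; _:*_; _:=_)

open import Data.Rational using (ℚ; _*_; _-_)
open import Data.Product using (_,_)
open import Data.Fin.Subset using (∣_∣)
open import Data.Fin.Subset.Properties using (⊆-refl)

lemma4p1 : (n : ℕ) (G : Graph n) (α β : ℚ) (Δ : ℕ) →
    IsExpander G α β → MaxDegree G Δ →
    IsWirelessExpander G α ((⟦ 2 ⟧ * β) - ⟦ Δ ⟧)
lemma4p1 n G α β Δ expands (degree≤Δ , _) S small =
  S , ⊆-refl ,
  Embedding.scaled-bound β (∣ S ∣) (∣ Γ⁻ G S ∣) (∣ UniqueNbrs G S S ∣) Δ
    (expands S small) (Counting.2∣Γ⁻∣≤∣unique∣+Δ∣S∣ G S Δ degree≤Δ)
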